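{- There is an absolute constant $C>0$ such that the following holds. Let $H=([n],E)$ be an undirected graph with $|E|\ge\binom n2-s$, where $s$ is a nonnegative integer, and let $\{K_{A_i,B_i}\}_{i\in[k]}$ (with $A_i,B_i\subseteq[n]$, $A_i\cap B_i=\emptyset$) be a biclique cover of $H$. Then $$\sum_{i=1}^k\big(|A_i|+|B_i|\big)\ge n\log_2 n-n\log_2\frac{s+n}{n}-Cn.$$
   Context: $K_{A,B}$ denotes the undirected complete bipartite graph on vertex set $A\sqcup B$ with edge set $\{\{a,b\}: a\in A, b\in B\}$. A biclique cover of an undirected graph $H=([n],E)$ is a collection of complete bipartite graphs $K_{A_i,B_i}$ ($A_i,B_i\subseteq[n]$ disjoint), each a subgraph of $H$, such that every edge of $H$ lies in some $K_{A_i,B_i}$. -}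

module Defs where

open import Data.Nat using (ℕ; zero; suc; _+_; _<ᵇ_)
open import Data.Bool using (Bool; true; false; _∧_; if_then_else_)
open import Data.Fin using (Fin; toℕ)
open import Data.Fin.Subset using (Subset; _∈_; ∣_∣)
open import Data.Product using (_×_; ∃-syntax)
open import Data.Sum using (_⊎_)
open import Relation.Binary.PropositionalEquality using (_≡_)
open import Relation.Nullary using (¬_)

Σ[<_]_ : (k : ℕ) → (Fin k → ℕ) → ℕ
Σ[< zero ] f = 0
Σ[< suc k ] f = f Data.Fin.zero + Σ[< k ] (λ i → f (Data.Fin.suc i))

Adj : ℕ → Set
Adj n = Fin n → Fin n → Bool

IsSimpleGraph : ∀ {n} → Adj n → Set
IsSimpleGraph {n} adj =
  (∀ (x y : Fin n) → adj x y ≡ adj y x) × (∀ (x : Fin n) → adj x x ≡ false)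

edgeCount : ∀ {n} → Adj n → ℕ
edgeCount {n} adj =
  Σ[< n ] (λ x → Σ[< n ] (λ y →
    if (toℕ x <ᵇ toℕ y) ∧ adj x y then 1 else 0))

IsBicliqueCover : ∀ {n k} → Adj n → (A B : Fin k → Subset n) → Set
IsBicliqueCover {n} {k} adj A B =
  (∀ (i : Fin k) (x : Fin n) → ¬ (x ∈ A i × x ∈ B i))
  × (∀ (i : Fin k) (a b : Fin n) → a ∈ A i → b ∈ B i → adj a b ≡ true)
  × (∀ (x y : Fin n) → adj x y ≡ true →
       ∃[ i ] ((x ∈ A i × y ∈ B i) ⊎ (y ∈ A i × x ∈ B i)))

coverCost : ∀ {n k} → (A B : Fin k → Subset n) → ℕ
coverCost {n} {k} A B = Σ[< k ] (λ i → ∣ A i ∣ + ∣ B i ∣)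

-- Write d(u) for the number of non-neighbours of u (u itself included) and e(u) for the number
-- of bicliques whose vertex set misses u, so that the cost of the cover is Σ_u (k − e(u)).
-- Splitting along the first biclique and inducting on k gives Σ_u 2^e(u) / d(u) ≤ 2^k: once no
-- biclique is left, the current vertex set spans no edge, so it has at most d(u) elements for
-- each of its members u. AM-GM turns this into n^n ≤ 2^cost · ∏ d(u), and a second AM-GM bounds
-- n^n ∏ d(u) by (Σ d(u))^n ≤ (2(s + n))^n. Denominators are cleared by ∏ d(u) throughout.

module Submission where

open import Data.Bool using (Bool; true; false; not; _∧_; if_then_else_)
open import Data.Bool.Properties using (∧-conicalˡ; ∧-conicalʳ; not-injective)
open import Data.Empty using (⊥-elim)
open import Data.Fin using (Fin; zero; suc; toℕ)
open import Data.Fin.Subset using (Subset; _∈_; ∣_∣)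
open import Data.Nat
open import Data.Nat.Combinatorics using (_C_; nC1≡n; nCk+nC[k+1]≡[n+1]C[k+1])
open import Data.Nat.Properties
open import Data.Nat.Tactic.RingSolver using (solve-∀)
open import Data.Product using (_×_; _,_; ∃-syntax)
open import Data.Sum using (_⊎_; inj₁; inj₂; [_,_]′)
open import Data.Vec using (lookup; _∷_; [])
open import Data.Vec.Functional using (removeAt)
open import Data.Vec.Properties using ([]=⇒lookup; lookup⇒[]=)
open import Function using (_∘_)
open import Relation.Binary.PropositionalEquality
open import Relation.Nullary using (¬_)
open import Defs

open import Algebra.Properties.Semiring.Sum +-*-semiring
  using (sum; sum-cong-≗; ∑-distrib-+; ∑-comm; *-distribˡ-sum)
open import Algebra.Properties.CommutativeSemigroup *-commutativeSemigroup using (x∙yz≈y∙xz; x∙yz≈z∙yx; interchange)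
open import Algebra.Properties.CommutativeMonoid.Sum *-1-commutativeMonoid
  using () renaming (sum to product; sum-cong-≗ to product-cong-≗; ∑-distrib-+ to product-distrib-*; sum-remove to product-remove)

Σ[<]≡sum : ∀ k (f : Fin k → ℕ) → Σ[< k ] f ≡ sum f
Σ[<]≡sum zero    f = refl
Σ[<]≡sum (suc k) f = cong (f zero +_) (Σ[<]≡sum k (f ∘ suc))

sum-mono-≤ : ∀ {k} {f g : Fin k → ℕ} → (∀ i → f i ≤ g i) → sum f ≤ sum g
sum-mono-≤ {zero}  f≤g = z≤n
sum-mono-≤ {suc k} f≤g = +-mono-≤ (f≤g zero) (sum-mono-≤ (f≤g ∘ suc))

sum-const : ∀ k c → sum {k} (λ _ → c) ≡ k * c
sum-const zero    c = refl
sum-const (suc k) c = cong (c +_) (sum-const k c)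

f≤sum : ∀ {k} (f : Fin k → ℕ) i → f i ≤ sum f
f≤sum f zero    = m≤m+n _ _
f≤sum f (suc i) = ≤-trans (f≤sum (f ∘ suc) i) (m≤n+m _ (f zero))

product-const : ∀ k c → product {k} (λ _ → c) ≡ c ^ k
product-const zero    c = refl
product-const (suc k) c = cong (c *_) (product-const k c)

product-^ : ∀ k b (f : Fin k → ℕ) → product (λ i → b ^ f i) ≡ b ^ sum f
product-^ zero    b f = refl
product-^ (suc k) b f =
  trans (cong (b ^ f zero *_) (product-^ k b (f ∘ suc))) (sym (^-distribˡ-+-* b (f zero) _))

1≤product : ∀ {k} {f : Fin k → ℕ} → (∀ i → 1 ≤ f i) → 1 ≤ product f
1≤product {zero}  1≤f = ≤-refl
1≤product {suc k} 1≤f = *-mono-≤ (1≤f zero) (1≤product (1≤f ∘ suc))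

productExcept : ∀ {k} → (Fin k → ℕ) → Fin k → ℕ
productExcept {suc k} f i = product (removeAt f i)

product≡*productExcept : ∀ {k} (f : Fin k → ℕ) i → product f ≡ f i * productExcept f i
product≡*productExcept {suc k} f i = product-remove f

^-distrib-* : ∀ a b n → (a * b) ^ n ≡ a ^ n * b ^ n
^-distrib-* a b zero = refl
^-distrib-* a b (suc n) = begin
  a * b * (a * b) ^ n     ≡⟨ cong (a * b *_) (^-distrib-* a b n) ⟩
  a * b * (a ^ n * b ^ n) ≡⟨ interchange a b (a ^ n) (b ^ n) ⟩
  a * a ^ n * (b * b ^ n) ∎
  where open ≡-Reasoning

2*m*n≤m*m+n*n : ∀ m n → 2 * (m * n) ≤ m * m + n * n
2*m*n≤m*m+n*n m n = [ ordered , swapped ]′ (≤-total m n)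
  where
  ordered : ∀ {m n} → m ≤ n → 2 * (m * n) ≤ m * m + n * n
  ordered {m} m≤n with d , refl ← m≤n⇒∃[o]m+o≡n m≤n =
    ≤-trans (m≤m+n _ (d * d)) (≤-reflexive (square m d))
    where
    square : ∀ m d → 2 * (m * (m + d)) + d * d ≡ m * m + (m + d) * (m + d)
    square = solve-∀
  swapped : n ≤ m → 2 * (m * n) ≤ m * m + n * n
  swapped n≤m = subst₂ _≤_ (cong (2 *_) (*-comm n m)) (+-comm (n * n) (m * m)) (ordered n≤m)

-- a ^ suc n ≥ b ^ n (suc n · a − n · b): x ↦ x ^ suc n lies above its tangent at b.
^-tangent : ∀ n a b → suc n * a * b ^ n ≤ a ^ suc n + n * b ^ suc n
^-tangent zero a b = ≤-reflexive (linear a b)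
  where
  linear : ∀ a b → 1 * a * 1 ≡ a * 1 + 0 * (b * 1)
  linear = solve-∀
^-tangent (suc n) a b = +-cancelʳ-≤ (n * (a * b ^ suc n)) _ _ (begin
    suc (suc n) * a * (b * b ^ n) + n * (a * (b * b ^ n))
      ≡⟨ collect n a b (b ^ n) ⟩
    suc n * b ^ n * (2 * (a * b))
      ≤⟨ *-monoʳ-≤ (suc n * b ^ n) (2*m*n≤m*m+n*n a b) ⟩
    suc n * b ^ n * (a * a + b * b)
      ≡⟨ distribute n a b (b ^ n) ⟩
    a * (suc n * a * b ^ n) + suc n * (b * (b * b ^ n))
      ≤⟨ +-monoˡ-≤ _ (*-monoʳ-≤ a (^-tangent n a b)) ⟩
    a * (a ^ suc n + n * b ^ suc n) + suc n * (b * (b * b ^ n))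
      ≡⟨ regroup n a b (a ^ suc n) (b ^ n) ⟩
    a * a ^ suc n + suc n * (b * (b * b ^ n)) + n * (a * (b * b ^ n)) ∎)
  where
  open ≤-Reasoning
  collect : ∀ n a b B → suc (suc n) * a * (b * B) + n * (a * (b * B)) ≡ suc n * B * (2 * (a * b))
  collect = solve-∀
  distribute : ∀ n a b B → suc n * B * (a * a + b * b) ≡ a * (suc n * a * B) + suc n * (b * (b * B))
  distribute = solve-∀
  regroup : ∀ n a b A B → a * (A + n * (b * B)) + suc n * (b * (b * B)) ≡ a * A + suc n * (b * (b * B)) + n * (a * (b * B))
  regroup = solve-∀

-- Weighted AM-GM for a and n copies of S / n. For n > 0 it is the tangent inequality with
-- a := n (a + S) and b := (suc n) S, divided by n.
amgm-step : ∀ n a S → suc n ^ suc n * a * S ^ n ≤ n ^ n * (a + S) ^ suc n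
amgm-step zero a S = begin
    1 * 1 * a * 1    ≡⟨ unit a ⟩
    a                ≤⟨ m≤m+n a S ⟩
    a + S            ≡⟨ unit′ (a + S) ⟨
    1 * (a + S) ^ 1  ∎
  where
  open ≤-Reasoning
  unit : ∀ a → 1 * 1 * a * 1 ≡ a
  unit = solve-∀
  unit′ : ∀ a → 1 * (a * 1) ≡ a
  unit′ = solve-∀
amgm-step n@(suc _) a S = *-cancelˡ-≤ n (+-cancelʳ-≤ (n * B ^ suc n) _ _ (begin
    n * (suc n ^ suc n * a * S ^ n) + n * (B * B ^ n)
      ≡⟨ cong (λ x → n * (suc n ^ suc n * a * S ^ n) + n * (B * x)) Bⁿ ⟩
    n * (suc n ^ suc n * a * S ^ n) + n * (B * (suc n ^ n * S ^ n))
      ≡⟨ expand n a S (suc n ^ n) (S ^ n) ⟩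
    suc n * A * (suc n ^ n * S ^ n)
      ≡⟨ cong (suc n * A *_) Bⁿ ⟨
    suc n * A * B ^ n
      ≤⟨ ^-tangent n A B ⟩
    A ^ suc n + n * B ^ suc n
      ≡⟨ cong (_+ n * B ^ suc n) (trans (^-distrib-* n (a + S) (suc n)) (*-assoc n (n ^ n) _)) ⟩
    n * (n ^ n * (a + S) ^ suc n) + n * B ^ suc n ∎))
  where
  open ≤-Reasoning
  A = n * (a + S)
  B = suc n * S
  Bⁿ : B ^ n ≡ suc n ^ n * S ^ n
  Bⁿ = ^-distrib-* (suc n) S n
  expand : ∀ n a S P Q → n * (suc n * P * a * Q) + n * (suc n * S * (P * Q)) ≡ suc n * (n * (a + S)) * (P * Q)
  expand = solve-∀

n^n≢0 : ∀ n → NonZero (n ^ n)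
n^n≢0 zero = _
n^n≢0 n@(suc _) = m^n≢0 n n

amgm : ∀ n (f : Fin n → ℕ) → n ^ n * product f ≤ sum f ^ n
amgm zero f = ≤-refl
amgm (suc n) f = *-cancelˡ-≤ (n ^ n) {{n^n≢0 n}} (begin
    n ^ n * (suc n ^ suc n * (a * P)) ≡⟨ regroup (n ^ n) (suc n ^ suc n) a P ⟩
    suc n ^ suc n * a * (n ^ n * P)   ≤⟨ *-monoʳ-≤ (suc n ^ suc n * a) (amgm n (f ∘ suc)) ⟩
    suc n ^ suc n * a * S ^ n         ≤⟨ amgm-step n a S ⟩
    n ^ n * (a + S) ^ suc n           ∎)
  where
  open ≤-Reasoning
  a = f zero
  P = product (f ∘ suc)
  S = sum (f ∘ suc)
  regroup : ∀ N M a P → N * (M * (a * P)) ≡ M * a * (N * P)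
  regroup = solve-∀

𝟙 : Bool → ℕ
𝟙 b = if b then 1 else 0

sum-𝟙*≤ : ∀ {k} (b : Fin k → Bool) (f : Fin k → ℕ) M → (∀ i → b i ≡ true → f i ≤ M) →
  sum (λ i → 𝟙 (b i) * f i) ≤ M * sum (𝟙 ∘ b)
sum-𝟙*≤ b f M f≤M = begin
  sum (λ i → 𝟙 (b i) * f i) ≤⟨ sum-mono-≤ bounded ⟩
  sum (λ i → M * 𝟙 (b i))   ≡⟨ *-distribˡ-sum M (𝟙 ∘ b) ⟨
  M * sum (𝟙 ∘ b)           ∎
  where
  open ≤-Reasoning
  bounded : ∀ i → 𝟙 (b i) * f i ≤ M * 𝟙 (b i)
  bounded i with b i in bᵢ
  ... | false = z≤n
  ... | true  = subst₂ _≤_ (sym (+-identityʳ (f i))) (sym (*-identityʳ M)) (f≤M i bᵢ)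

∣p∣≡sum : ∀ {k} (p : Subset k) → ∣ p ∣ ≡ sum (𝟙 ∘ lookup p)
∣p∣≡sum []          = refl
∣p∣≡sum (true ∷ p)  = cong suc (∣p∣≡sum p)
∣p∣≡sum (false ∷ p) = ∣p∣≡sum p

sum-𝟙-≡ᵇ : ∀ {n} (u : Fin n) → sum (λ (v : Fin n) → 𝟙 (toℕ u ≡ᵇ toℕ v)) ≡ 1
sum-𝟙-≡ᵇ {suc n} zero    = cong suc (trans (sum-const n 0) (*-zeroʳ n))
sum-𝟙-≡ᵇ {suc n} (suc u) = sum-𝟙-≡ᵇ u

sum-𝟙-<ᵇ≡C2 : ∀ n → sum (λ (u : Fin n) → sum (λ (v : Fin n) → 𝟙 (toℕ u <ᵇ toℕ v))) ≡ n C 2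
sum-𝟙-<ᵇ≡C2 zero    = refl
sum-𝟙-<ᵇ≡C2 (suc n) = begin
  sum {n} (λ _ → 1) + sum (λ (u : Fin n) → sum (λ (v : Fin n) → 𝟙 (toℕ u <ᵇ toℕ v)))
    ≡⟨ cong₂ _+_ (trans (sum-const n 1) (*-identityʳ n)) (sum-𝟙-<ᵇ≡C2 n) ⟩
  n + n C 2       ≡⟨ cong (_+ n C 2) (nC1≡n n) ⟨
  n C 1 + n C 2   ≡⟨ nCk+nC[k+1]≡[n+1]C[k+1] n 1 ⟩
  suc n C 2       ∎
  where open ≡-Reasoning

<ᵇ-trichotomy : ∀ a b → (a <ᵇ b) ≡ false → (b <ᵇ a) ≡ false → (a ≡ᵇ b) ≡ true
<ᵇ-trichotomy zero    zero    _ _ = refl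
<ᵇ-trichotomy (suc a) (suc b) a≮b b≮a = <ᵇ-trichotomy a b a≮b b≮a

module NonNeighbours {n : ℕ} (adj : Adj n) where

  nonDegree : Fin n → ℕ
  nonDegree u = sum (λ v → 𝟙 (not (adj u v)))

  nonEdge : Fin n → Fin n → ℕ
  nonEdge u v = 𝟙 ((toℕ u <ᵇ toℕ v) ∧ not (adj u v))

  edge : Fin n → Fin n → ℕ
  edge u v = 𝟙 ((toℕ u <ᵇ toℕ v) ∧ adj u v)

  nonEdgeCount : ℕ
  nonEdgeCount = sum (λ u → sum (nonEdge u))

  edgeCount≡ : edgeCount adj ≡ sum (λ u → sum (edge u))
  edgeCount≡ = trans (Σ[<]≡sum n (λ u → Σ[< n ] edge u)) (sum-cong-≗ (λ u → Σ[<]≡sum n (edge u)))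

  nonEdgeCount+edgeCount≡C2 : nonEdgeCount + edgeCount adj ≡ n C 2
  nonEdgeCount+edgeCount≡C2 = begin
    nonEdgeCount + edgeCount adj
      ≡⟨ cong (nonEdgeCount +_) edgeCount≡ ⟩
    nonEdgeCount + sum (λ u → sum (edge u))
      ≡⟨ ∑-distrib-+ (λ u → sum (nonEdge u)) (λ u → sum (edge u)) ⟨
    sum (λ u → sum (nonEdge u) + sum (edge u))
      ≡⟨ sum-cong-≗ (λ u → trans (sym (∑-distrib-+ (nonEdge u) (edge u))) (sum-cong-≗ (split u))) ⟩
    sum (λ (u : Fin n) → sum (λ (v : Fin n) → 𝟙 (toℕ u <ᵇ toℕ v)))
      ≡⟨ sum-𝟙-<ᵇ≡C2 n ⟩
    n C 2 ∎
    where
    open ≡-Reasoning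
    split : ∀ u v → nonEdge u v + edge u v ≡ 𝟙 (toℕ u <ᵇ toℕ v)
    split u v with toℕ u <ᵇ toℕ v | adj u v
    ... | true  | true  = refl
    ... | true  | false = refl
    ... | false | _     = refl

  sum-nonDegree≤nonEdges : (∀ x y → adj x y ≡ adj y x) → sum nonDegree ≤ nonEdgeCount + nonEdgeCount + n
  sum-nonDegree≤nonEdges symmetric = begin
    sum nonDegree
      ≤⟨ sum-mono-≤ (λ u → sum-mono-≤ (nonEdge≤ u)) ⟩
    sum (λ u → sum (λ v → nonEdge u v + nonEdge v u + 𝟙 (toℕ u ≡ᵇ toℕ v)))
      ≡⟨ sum-cong-≗ (λ u → trans (∑-distrib-+ (λ v → nonEdge u v + nonEdge v u) (λ (v : Fin n) → 𝟙 (toℕ u ≡ᵇ toℕ v)))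
                                  (cong₂ _+_ (∑-distrib-+ (nonEdge u) (λ v → nonEdge v u)) (sum-𝟙-≡ᵇ u))) ⟩
    sum (λ u → sum (nonEdge u) + sum (λ v → nonEdge v u) + 1)
      ≡⟨ trans (∑-distrib-+ (λ u → sum (nonEdge u) + sum (λ v → nonEdge v u)) (λ _ → 1))
               (cong₂ _+_ (∑-distrib-+ (λ u → sum (nonEdge u)) (λ u → sum (λ v → nonEdge v u)))
                          (trans (sum-const n 1) (*-identityʳ n))) ⟩
    nonEdgeCount + sum (λ u → sum (λ v → nonEdge v u)) + n
      ≡⟨ cong (λ x → nonEdgeCount + x + n) (∑-comm (λ u v → nonEdge v u)) ⟩
    nonEdgeCount + nonEdgeCount + n ∎
    where
    open ≤-Reasoning
    nonEdge≤ : ∀ u v → 𝟙 (not (adj u v)) ≤ nonEdge u v + nonEdge v u + 𝟙 (toℕ u ≡ᵇ toℕ v)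
    nonEdge≤ u v with adj u v in uv | toℕ u <ᵇ toℕ v in u<v | toℕ v <ᵇ toℕ u in v<u
    ... | true  | _     | _     = z≤n
    ... | false | true  | _     = s≤s z≤n
    ... | false | false | true  rewrite symmetric v u | uv = s≤s z≤n
    ... | false | false | false rewrite <ᵇ-trichotomy (toℕ u) (toℕ v) u<v v<u = s≤s z≤n

  nonEdgeCount≤ : ∀ s → n C 2 ≤ edgeCount adj + s → nonEdgeCount ≤ s
  nonEdgeCount≤ s C2≤ = +-cancelʳ-≤ (edgeCount adj) nonEdgeCount s (begin
    nonEdgeCount + edgeCount adj ≡⟨ nonEdgeCount+edgeCount≡C2 ⟩
    n C 2                        ≤⟨ C2≤ ⟩
    edgeCount adj + s            ≡⟨ +-comm (edgeCount adj) s ⟩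
    s + edgeCount adj            ∎)
    where open ≤-Reasoning

  sum-nonDegree≤ : (∀ x y → adj x y ≡ adj y x) → ∀ s → n C 2 ≤ edgeCount adj + s →
    sum nonDegree ≤ 2 * (s + n)
  sum-nonDegree≤ symmetric s C2≤ = begin
    sum nonDegree                    ≤⟨ sum-nonDegree≤nonEdges symmetric ⟩
    nonEdgeCount + nonEdgeCount + n  ≤⟨ +-monoˡ-≤ n (+-mono-≤ (nonEdgeCount≤ s C2≤) (nonEdgeCount≤ s C2≤)) ⟩
    s + s + n                        ≤⟨ m≤m+n (s + s + n) n ⟩
    s + s + n + n                    ≡⟨ double s n ⟩
    2 * (s + n)                      ∎
    where
    open ≤-Reasoning
    double : ∀ s n → s + s + n + n ≡ 2 * (s + n)
    double = solve-∀

Disjoint : ∀ {n k} (A B : Fin k → Subset n) → Set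
Disjoint A B = ∀ i x → ¬ (x ∈ A i × x ∈ B i)

missCount : ∀ {n k} (A B : Fin k → Subset n) → Fin n → ℕ
missCount A B u = sum (λ i → 𝟙 (not (lookup (A i) u) ∧ not (lookup (B i) u)))

hitCount : ∀ {n k} (A B : Fin k → Subset n) → Fin n → ℕ
hitCount A B u = sum (λ i → 𝟙 (lookup (A i) u) + 𝟙 (lookup (B i) u))

coverCost≡sum-hitCount : ∀ {n k} (A B : Fin k → Subset n) → coverCost A B ≡ sum (hitCount A B)
coverCost≡sum-hitCount {n} {k} A B = begin
  Σ[< k ] (λ i → ∣ A i ∣ + ∣ B i ∣)
    ≡⟨ Σ[<]≡sum k _ ⟩
  sum (λ i → ∣ A i ∣ + ∣ B i ∣)
    ≡⟨ sum-cong-≗ (λ i → trans (cong₂ _+_ (∣p∣≡sum (A i)) (∣p∣≡sum (B i))) (sym (∑-distrib-+ (𝟙 ∘ lookup (A i)) (𝟙 ∘ lookup (B i))))) ⟩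
  sum (λ i → sum (λ u → 𝟙 (lookup (A i) u) + 𝟙 (lookup (B i) u)))
    ≡⟨ ∑-comm (λ i u → 𝟙 (lookup (A i) u) + 𝟙 (lookup (B i) u)) ⟩
  sum (hitCount A B) ∎
  where open ≡-Reasoning

lookup≡false⇒∉ : ∀ {n} (p : Subset n) x → lookup p x ≡ false → ¬ x ∈ p
lookup≡false⇒∉ p x px x∈p with () ← trans (sym ([]=⇒lookup x∈p)) px

sum-missCount+sum-hitCount≡ : ∀ {n k} (A B : Fin k → Subset n) → Disjoint A B →
  sum (missCount A B) + sum (hitCount A B) ≡ k * n
sum-missCount+sum-hitCount≡ {n} {k} A B disjoint = begin
  sum (missCount A B) + sum (hitCount A B)   ≡⟨ ∑-distrib-+ (missCount A B) (hitCount A B) ⟨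
  sum (λ u → missCount A B u + hitCount A B u) ≡⟨ sum-cong-≗ missed-or-hit ⟩
  sum {n} (λ _ → k)                          ≡⟨ sum-const n k ⟩
  n * k                                      ≡⟨ *-comm n k ⟩
  k * n                                      ∎
  where
  open ≡-Reasoning
  missed-or-hit : ∀ u → missCount A B u + hitCount A B u ≡ k
  missed-or-hit u = begin
    missCount A B u + hitCount A B u  ≡⟨ ∑-distrib-+ (λ i → 𝟙 (not (a i) ∧ not (b i))) (λ i → 𝟙 (a i) + 𝟙 (b i)) ⟨
    sum (λ i → 𝟙 (not (a i) ∧ not (b i)) + (𝟙 (a i) + 𝟙 (b i)))
                                      ≡⟨ sum-cong-≗ exactly-one ⟩
    sum {k} (λ _ → 1)                 ≡⟨ trans (sum-const k 1) (*-identityʳ k) ⟩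
    k                                 ∎
    where
    a b : Fin k → Bool
    a i = lookup (A i) u
    b i = lookup (B i) u
    exactly-one : ∀ i → 𝟙 (not (a i) ∧ not (b i)) + (𝟙 (a i) + 𝟙 (b i)) ≡ 1
    exactly-one i with a i in aᵢ | b i in bᵢ
    ... | true  | true  = ⊥-elim (disjoint i u (lookup⇒[]= u (A i) aᵢ , lookup⇒[]= u (B i) bᵢ))
    ... | true  | false = refl
    ... | false | true  = refl
    ... | false | false = refl

module Potential {n : ℕ} (adj : Adj n) (irreflexive : ∀ x → adj x x ≡ false) where

  open NonNeighbours adj

  1≤nonDegree : ∀ u → 1 ≤ nonDegree u
  1≤nonDegree u = subst (λ b → 𝟙 (not b) ≤ nonDegree u) (irreflexive u) (f≤sum (λ v → 𝟙 (not (adj u v))) u)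

  W : ℕ
  W = product nonDegree

  W∖ : Fin n → ℕ
  W∖ = productExcept nonDegree

  nonDegree*W∖≡W : ∀ u → nonDegree u * W∖ u ≡ W
  nonDegree*W∖≡W u = sym (product≡*productExcept nonDegree u)

  W∖≤W : ∀ u → W∖ u ≤ W
  W∖≤W u = ≤-trans (m≤n*m (W∖ u) (nonDegree u) {{>-nonZero (1≤nonDegree u)}}) (≤-reflexive (nonDegree*W∖≡W u))

  CoversWithin : ∀ {k} (A B : Fin k → Subset n) → (Fin n → Bool) → Set
  CoversWithin A B T = ∀ x y → T x ≡ true → T y ≡ true → adj x y ≡ true →
    ∃[ i ] ((x ∈ A i × y ∈ B i) ⊎ (y ∈ A i × x ∈ B i))

  independent-sum≤W : ∀ (T : Fin n → Bool) → (∀ u v → T u ≡ true → T v ≡ true → adj u v ≡ false) →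
    sum (λ u → 𝟙 (T u) * W∖ u) ≤ W
  independent-sum≤W T independent = cancel t X≤W*t t*X≤t*W
    where
    open ≤-Reasoning
    t X : ℕ
    t = sum (𝟙 ∘ T)
    X = sum (λ u → 𝟙 (T u) * W∖ u)
    t≤nonDegree : ∀ u → T u ≡ true → t ≤ nonDegree u
    t≤nonDegree u Tu = sum-mono-≤ T⊆nonNeighbours
      where
      T⊆nonNeighbours : ∀ v → 𝟙 (T v) ≤ 𝟙 (not (adj u v))
      T⊆nonNeighbours v with T v in Tv
      ... | false = z≤n
      ... | true rewrite independent u v Tu Tv = ≤-refl
    X≤W*t : X ≤ W * t
    X≤W*t = sum-𝟙*≤ T W∖ W (λ u _ → W∖≤W u)
    t*X≤t*W : t * X ≤ t * W
    t*X≤t*W = begin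
      t * X                               ≡⟨ *-distribˡ-sum t (λ u → 𝟙 (T u) * W∖ u) ⟩
      sum (λ u → t * (𝟙 (T u) * W∖ u))    ≡⟨ sum-cong-≗ (λ u → x∙yz≈y∙xz t (𝟙 (T u)) (W∖ u)) ⟩
      sum (λ u → 𝟙 (T u) * (t * W∖ u))    ≤⟨ sum-𝟙*≤ T (λ u → t * W∖ u) W t*W∖≤W ⟩
      W * t                               ≡⟨ *-comm W t ⟩
      t * W                               ∎
      where
      t*W∖≤W : ∀ u → T u ≡ true → t * W∖ u ≤ W
      t*W∖≤W u Tu = ≤-trans (*-monoˡ-≤ (W∖ u) (t≤nonDegree u Tu)) (≤-reflexive (nonDegree*W∖≡W u))
    -- the first hypothesis settles t = 0, where the second one says nothing
    cancel : ∀ t {x y} → x ≤ y * t → t * x ≤ t * y → x ≤ y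
    cancel zero    {y = y} x≤0 _ = ≤-trans x≤0 (≤-trans (≤-reflexive (*-zeroʳ y)) z≤n)
    cancel (suc t) _ ≤ = *-cancelˡ-≤ (suc t) ≤

  -- weight A B u = W · 2^(missCount A B u) / nonDegree u.
  weight : ∀ {k} (A B : Fin k → Subset n) → Fin n → ℕ
  weight A B u = W∖ u * 2 ^ missCount A B u

  potential : ∀ {k} (A B : Fin k → Subset n) → (Fin n → Bool) → ℕ
  potential A B T = sum (λ u → 𝟙 (T u) * weight A B u)

  restrict-covers : ∀ {k} {A B : Fin (suc k) → Subset n} {T S : Fin n → Bool} →
    CoversWithin A B T → (∀ u → S u ≡ true → T u ≡ true) →
    (∀ x y → S x ≡ true → S y ≡ true → ¬ (x ∈ A zero × y ∈ B zero)) →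
    CoversWithin (A ∘ suc) (B ∘ suc) S
  restrict-covers covers S⊆T uncovered x y Sx Sy xy with covers x y (S⊆T x Sx) (S⊆T y Sy) xy
  ... | suc i , xy∈Kᵢ          = i , xy∈Kᵢ
  ... | zero  , inj₁ x∈A×y∈B   = ⊥-elim (uncovered x y Sx Sy x∈A×y∈B)
  ... | zero  , inj₂ y∈A×x∈B   = ⊥-elim (uncovered y x Sy Sx y∈A×x∈B)

  -- T ∖ B₀ and T ∖ A₀ together cover T, and no edge inside either is covered by K_{A₀,B₀}.
  -- A vertex missed by K_{A₀,B₀} lies in both, which the factor 2 in its weight pays for.
  potential≤ : ∀ {k} (A B : Fin k → Subset n) T → Disjoint A B → CoversWithin A B T →
    potential A B T ≤ 2 ^ k * W
  potential≤ {zero} A B T _ covers = begin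
    potential A B T              ≡⟨ sum-cong-≗ (λ u → cong (𝟙 (T u) *_) (*-identityʳ (W∖ u))) ⟩
    sum (λ u → 𝟙 (T u) * W∖ u)   ≤⟨ independent-sum≤W T independent ⟩
    W                            ≡⟨ *-identityˡ W ⟨
    1 * W                        ∎
    where
    open ≤-Reasoning
    independent : ∀ u v → T u ≡ true → T v ≡ true → adj u v ≡ false
    independent u v Tu Tv with adj u v in uv
    ... | false = refl
    ... | true with () , _ ← covers u v Tu Tv uv
  potential≤ {suc k} A B T disjoint covers = begin
    potential A B T
      ≡⟨ trans (sum-cong-≗ split) (∑-distrib-+ (term T∖B₀) (term T∖A₀)) ⟩
    potential A′ B′ T∖B₀ + potential A′ B′ T∖A₀
      ≤⟨ +-mono-≤ (potential≤ A′ B′ T∖B₀ disjoint′ covers∖B₀) (potential≤ A′ B′ T∖A₀ disjoint′ covers∖A₀) ⟩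
    2 ^ k * W + 2 ^ k * W
      ≡⟨ double (2 ^ k) W ⟩
    2 ^ suc k * W ∎
    where
    open ≤-Reasoning
    A′ B′ : Fin k → Subset n
    A′ = A ∘ suc
    B′ = B ∘ suc
    disjoint′ : Disjoint A′ B′
    disjoint′ = disjoint ∘ suc
    T∖A₀ T∖B₀ : Fin n → Bool
    T∖A₀ u = T u ∧ not (lookup (A zero) u)
    T∖B₀ u = T u ∧ not (lookup (B zero) u)
    term : (Fin n → Bool) → Fin n → ℕ
    term S u = 𝟙 (S u) * weight A′ B′ u
    split : ∀ u → 𝟙 (T u) * weight A B u ≡ term T∖B₀ u + term T∖A₀ u
    split u with T u | lookup (A zero) u in a | lookup (B zero) u in b
    ... | false | _     | _     = refl
    ... | true  | true  | true  = ⊥-elim (disjoint zero u (lookup⇒[]= u (A zero) a , lookup⇒[]= u (B zero) b))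
    ... | true  | true  | false = sym (+-identityʳ _)
    ... | true  | false | true  = refl
    ... | true  | false | false = twice (W∖ u) (2 ^ missCount A′ B′ u)
      where
      twice : ∀ x y → 1 * (x * (2 * y)) ≡ 1 * (x * y) + 1 * (x * y)
      twice = solve-∀
    double : ∀ x y → x * y + x * y ≡ 2 * x * y
    double = solve-∀
    covers∖B₀ : CoversWithin A′ B′ T∖B₀
    covers∖B₀ = restrict-covers covers (λ u → ∧-conicalˡ (T u) _)
      (λ x y _ Sy (_ , y∈B₀) → lookup≡false⇒∉ (B zero) y (not-injective (∧-conicalʳ (T y) _ Sy)) y∈B₀)
    covers∖A₀ : CoversWithin A′ B′ T∖A₀
    covers∖A₀ = restrict-covers covers (λ u → ∧-conicalˡ (T u) _)
      (λ x y Sx _ (x∈A₀ , _) → lookup≡false⇒∉ (A zero) x (not-injective (∧-conicalʳ (T x) _ Sx)) x∈A₀)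

  W*product-W∖≡W^n : W * product W∖ ≡ W ^ n
  W*product-W∖≡W^n = begin
    W * product W∖                         ≡⟨ product-distrib-* nonDegree W∖ ⟨
    product (λ u → nonDegree u * W∖ u)     ≡⟨ product-cong-≗ nonDegree*W∖≡W ⟩
    product {n} (λ _ → W)                  ≡⟨ product-const n W ⟩
    W ^ n                                  ∎
    where open ≡-Reasoning

  module _ {k} (A B : Fin k → Subset n) (disjoint : Disjoint A B) (covers : CoversWithin A B (λ _ → true)) where

    n^n*2^missed≤2^kn*W : n ^ n * 2 ^ sum (missCount A B) ≤ 2 ^ (k * n) * W
    n^n*2^missed≤2^kn*W = *-cancelˡ-≤ (W ^ n) {{m^n≢0 W n {{>-nonZero (1≤product 1≤nonDegree)}}}} (begin
      W ^ n * (n ^ n * 2 ^ E)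
        ≡⟨ cong (_* (n ^ n * 2 ^ E)) W*product-W∖≡W^n ⟨
      W * product W∖ * (n ^ n * 2 ^ E)
        ≡⟨ trans (*-assoc W _ _) (cong (W *_) (x∙yz≈y∙xz (product W∖) (n ^ n) (2 ^ E))) ⟩
      W * (n ^ n * (product W∖ * 2 ^ E))
        ≡⟨ cong (λ x → W * (n ^ n * x)) product-weight ⟨
      W * (n ^ n * product (weight A B))
        ≤⟨ *-monoʳ-≤ W (amgm n (weight A B)) ⟩
      W * sum (weight A B) ^ n
        ≤⟨ *-monoʳ-≤ W (^-monoˡ-≤ n sum-weight≤) ⟩
      W * (2 ^ k * W) ^ n
        ≡⟨ cong (W *_) (trans (^-distrib-* (2 ^ k) W n) (cong (_* W ^ n) (^-*-assoc 2 k n))) ⟩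
      W * (2 ^ (k * n) * W ^ n)
        ≡⟨ x∙yz≈z∙yx W (2 ^ (k * n)) (W ^ n) ⟩
      W ^ n * (2 ^ (k * n) * W) ∎)
      where
      open ≤-Reasoning
      E = sum (missCount A B)
      product-weight : product (weight A B) ≡ product W∖ * 2 ^ E
      product-weight = trans (product-distrib-* W∖ (λ u → 2 ^ missCount A B u))
                             (cong (product W∖ *_) (product-^ n 2 (missCount A B)))
      sum-weight≤ : sum (weight A B) ≤ 2 ^ k * W
      sum-weight≤ = ≤-trans (≤-reflexive (sum-cong-≗ (λ u → sym (*-identityˡ (weight A B u)))))
                            (potential≤ A B (λ _ → true) disjoint covers)

    n^n≤2^hits*W : n ^ n ≤ 2 ^ sum (hitCount A B) * W
    n^n≤2^hits*W = *-cancelˡ-≤ (2 ^ E) {{m^n≢0 2 E}} (begin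
      2 ^ E * n ^ n        ≡⟨ *-comm (2 ^ E) (n ^ n) ⟩
      n ^ n * 2 ^ E        ≤⟨ n^n*2^missed≤2^kn*W ⟩
      2 ^ (k * n) * W      ≡⟨ cong (λ x → 2 ^ x * W) (sum-missCount+sum-hitCount≡ A B disjoint) ⟨
      2 ^ (E + D) * W      ≡⟨ cong (_* W) (^-distribˡ-+-* 2 E D) ⟩
      2 ^ E * 2 ^ D * W    ≡⟨ *-assoc (2 ^ E) (2 ^ D) W ⟩
      2 ^ E * (2 ^ D * W)  ∎)
      where
      open ≤-Reasoning
      E = sum (missCount A B)
      D = sum (hitCount A B)

lemma3p17 : ∃[ c ] (0 < c × (∀ (n : ℕ) (adj : Adj n) → IsSimpleGraph adj →
    ∀ (s : ℕ) → n C 2 ≤ edgeCount adj + s →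
    ∀ (k : ℕ) (A B : Fin k → Subset n) → IsBicliqueCover adj A B →
    n ^ (2 * n) ≤ 2 ^ (coverCost A B + c * n) * (s + n) ^ n))
lemma3p17 = 1 , z<s , λ n adj (symmetric , irreflexive) s C2≤ k A B (disjoint , _ , covers) →
  let open NonNeighbours adj
      open Potential adj irreflexive
      D = sum (hitCount A B)
  in begin
    n ^ (2 * n)
      ≡⟨ trans (^-distribˡ-+-* n n (n + 0)) (cong (λ x → n ^ n * n ^ x) (+-identityʳ n)) ⟩
    n ^ n * n ^ n
      ≤⟨ *-monoʳ-≤ (n ^ n) (n^n≤2^hits*W A B disjoint (λ x y _ _ → covers x y)) ⟩
    n ^ n * (2 ^ D * W)
      ≡⟨ x∙yz≈y∙xz (n ^ n) (2 ^ D) W ⟩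
    2 ^ D * (n ^ n * W)
      ≤⟨ *-monoʳ-≤ (2 ^ D) (≤-trans (amgm n nonDegree) (^-monoˡ-≤ n (sum-nonDegree≤ symmetric s C2≤))) ⟩
    2 ^ D * (2 * (s + n)) ^ n
      ≡⟨ trans (cong (2 ^ D *_) (^-distrib-* 2 (s + n) n)) (sym (*-assoc (2 ^ D) (2 ^ n) _)) ⟩
    2 ^ D * 2 ^ n * (s + n) ^ n
      ≡⟨ cong (_* (s + n) ^ n) (^-distribˡ-+-* 2 D n) ⟨
    2 ^ (D + n) * (s + n) ^ n
      ≡⟨ cong (λ x → 2 ^ x * (s + n) ^ n)
              (cong₂ _+_ (coverCost≡sum-hitCount A B) (*-identityˡ n)) ⟨
    2 ^ (coverCost A B + 1 * n) * (s + n) ^ n ∎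
  where open ≤-Reasoning
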